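{- Let $n\ge2$ and $\tau_i=(c_i,d_i,p_i,J_i)$, $i=1,\dots,n$, nonnegative integers with $c_i\ge1$, $p_i\ge1$, $c_i\le d_i\le p_i$, $0\le J_i\le p_i$, $\sum_{i<n}c_i/p_i<1$, and harmonic periods. Let $\emptyset\ne I\subseteq\{1,\dots,n-1\}$, $\gamma\in\mathbb{Z}_{\ge1}$, and \[ \mathcal{R}(I,\gamma)=\min\Big\{t\in\mathbb{Z}_{\ge0}: t\ge \gamma+\sum_{i\in I}c_i\Big\lceil\frac{t+J_i}{p_i}\Big\rceil\Big\}. \] If $k$ is an integer with $k\ge\max_{i\in I}p_i$, then whether $\mathcal{R}(I,\gamma)\le k$ holds can be decided using $O(n^2)$ arithmetic operations.
   Context: Periods are harmonic if $p_i\ge p_j$ implies $p_i/p_j\in\mathbb{Z}$. Running times count arithmetic operations on numbers from the input. -}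

module Defs where

open import Data.Bool using (Bool; true; false; if_then_else_)
open import Data.Nat as ℕ using (ℕ; zero; suc; _≤_; _<_; _∸_)
open import Data.Nat.DivMod using () renaming (_/_ to _/ℕ_)
open import Data.Nat.Divisibility using (_∣_)
open import Data.Integer as ℤ using (ℤ; +_; -[1+_])
open import Data.Integer.DivMod using () renaming (_/_ to _/ℤ_)
open import Data.Rational.Unnormalised as Q using (ℚᵘ; 0ℚᵘ; 1ℚᵘ)
open import Data.Fin using (Fin; toℕ)
open import Data.Fin.Subset using (Subset; _∈_; Nonempty)
open import Data.List using (List; foldr; map)
open import Data.List using () renaming (allFin to allFinL)
open import Data.Product using (_×_; _,_; proj₁; proj₂; Σ; ∃)
open import Relation.Nullary using (¬_)

-- Task "n" of the paper is the last index (toℕ i ≡ n ∸ 1); the paper's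
-- indices 1..n-1 are those i with suc (toℕ i) < n.

Lower : {n : ℕ} → Fin n → Set
Lower {n} i = suc (toℕ i) < n

-- ceiling division on ℕ (used only with positive divisor); x / 0 := 0
ceilDiv : ℕ → ℕ → ℕ
ceilDiv x zero    = 0
ceilDiv x (suc q) = (x ℕ.+ q) /ℕ suc q

-- the rational c / p (used only with p ≥ 1); c / 0 := 0
frac : ℕ → ℕ → ℚᵘ
frac c zero    = 0ℚᵘ
frac c (suc q) = (+ c) Q./ suc q

utilLower : (n : ℕ) → (Fin n → ℕ) → (Fin n → ℕ) → ℚᵘ
utilLower n c p =
  foldr Q._+_ 0ℚᵘ
    (map (λ i → if suc (toℕ i) ℕ.<ᵇ n then frac (c i) (p i) else 0ℚᵘ) (allFinL n))

lookupB : {n : ℕ} → Subset n → Fin n → Bool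
lookupB I i = Data.Vec.lookup I i
  where import Data.Vec

demand : (n : ℕ) → Subset n → (c p J : Fin n → ℕ) → ℕ → ℕ
demand n I c p J t =
  foldr ℕ._+_ 0
    (map (λ i → if lookupB I i then c i ℕ.* ceilDiv (t ℕ.+ J i) (p i) else 0) (allFinL n))

Feasible : (n : ℕ) → Subset n → (c p J : Fin n → ℕ) → ℕ → ℕ → Set
Feasible n I c p J γ t = γ ℕ.+ demand n I c p J t ≤ t

IsR : (n : ℕ) → Subset n → (c p J : Fin n → ℕ) → ℕ → ℕ → Set
IsR n I c p J γ r =
  Feasible n I c p J γ r × (∀ t → Feasible n I c p J γ t → r ≤ t)

Harmonic : {n : ℕ} → (Fin n → ℕ) → Set
Harmonic p = ∀ i j → p j ≤ p i → p j ∣ p i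

-- Computational model: algebraic decision trees over an abstract number
-- type V.  Numbers can only be created by literals or arithmetic
-- operations and inspected only via comparisons; each such step costs 1.

data Op : Set where
  add sub mul quot : Op

data Prog (V : Set) : Set where
  done  : Bool → Prog V
  lit   : ℤ → (V → Prog V) → Prog V
  arith : Op → V → V → (V → Prog V) → Prog V
  leq   : V → V → (Bool → Prog V) → Prog V

-- integer division, with x div 0 := 0
safeDiv : ℤ → ℤ → ℤ
safeDiv x (+ zero)   = + zero
safeDiv x (+ suc m)  = x /ℤ (+ suc m)
safeDiv x -[1+ m ]   = x /ℤ -[1+ m ]

evalOp : Op → ℤ → ℤ → ℤ
evalOp add x y = x ℤ.+ y
evalOp sub x y = x ℤ.- y
evalOp mul x y = x ℤ.* y
evalOp quot x y = safeDiv x y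

run : Prog ℤ → Bool × ℕ
run (done b) = b , 0
run (lit z k) = let r = run (k z) in proj₁ r , suc (proj₂ r)
run (arith o x y k) = let r = run (k (evalOp o x y)) in proj₁ r , suc (proj₂ r)
run (leq x y k) = let r = run (k (x ℤ.≤ᵇ y)) in proj₁ r , suc (proj₂ r)

-- An algorithm: uniform in the number type V; it receives n and I as
-- combinatorial structure and the numeric input (c,d,p,J,γ,k) as values.
Algorithm : Set₁
Algorithm = (V : Set) → (n : ℕ) → Subset n →
            (c d p J : Fin n → V) → (γ k : V) → Prog V

record Hyps (n : ℕ) (c d p J : Fin n → ℕ) (I : Subset n) (γ k : ℕ) : Set where
  field
    n≥2      : 2 ≤ n
    c≥1      : ∀ i → 1 ≤ c i
    p≥1      : ∀ i → 1 ≤ p i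
    c≤d      : ∀ i → c i ≤ d i
    d≤p      : ∀ i → d i ≤ p i
    J≤p      : ∀ i → J i ≤ p i
    util<1   : utilLower n c p Q.< 1ℚᵘ
    harmonic : Harmonic p
    I-nonempty : Nonempty I
    I-lower  : ∀ i → i ∈ I → Lower i
    γ≥1      : 1 ≤ γ
    k≥maxP   : ∀ i → i ∈ I → p i ≤ k

{-# OPTIONS --safe #-}
module Submission where

-- Let D list the tasks of I by decreasing period and slack D t = t - Σ_{b ∈ D} c_b ⌈(t + J_b) / p_b⌉ for
-- t ∈ ℤ, so that R(I, γ) ≤ k iff γ ≤ slack D t for some t ∈ [0, k]. Harmonic periods and utilization < 1
-- give Σ c_b p_a / p_b ≤ p_a, summed over a task a of D and the tasks after it, so the slack of that suffix
-- does not decrease when t moves by a whole period p_a.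
-- This maximum obeys a recursion over D that splits t ≤ x at the last release of the first task a before x.
-- By the same periodicity the maximum for the remaining tasks at that release is its value at -J_a plus a
-- multiple of a fixed gain, so each task adds one evaluation point and the recursion costs O(n²) operations.

open import Data.Nat as ℕ using (ℕ)
import Data.Nat.Properties as ℕP
open import Data.Fin using (Fin)
open import Data.Fin.Subset using (Subset)
open import Defs using (Hyps; Harmonic)

module IntegerFloor where
  open import Data.Nat using (suc)
  open import Data.Nat.Divisibility using (_∣_; divides)
  open import Data.Integer using (ℤ; +_; 0ℤ; 1ℤ; _+_; _-_; _*_; _≤_; _<_; +≤+)
  open import Data.Integer.Properties
  open import Data.Integer.DivMod using (a≡a%n+[a/n]*n; n%d<d; _%_; _/_)
  open import Data.Integer.Tactic.RingSolver using (solve-∀)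
  open import Data.Product using (_×_; _,_; proj₁; proj₂)
  open import Relation.Binary.PropositionalEquality
  open import Defs using (safeDiv)

  -- Inequalities below are proved by letting solve-∀ compute the difference of the two sides.
  ≤-byDifference : ∀ {i j} d → j - i ≡ d → 0ℤ ≤ d → i ≤ j
  ≤-byDifference d eq 0≤d = 0≤i-j⇒j≤i (subst (0ℤ ≤_) (sym eq) 0≤d)

  <-byDifference : ∀ {i j} d → j - (1ℤ + i) ≡ d → 0ℤ ≤ d → i < j
  <-byDifference d eq 0≤d = suc[i]≤j⇒i<j (≤-byDifference d eq 0≤d)

  i<j⇒0≤j-[1+i] : ∀ {i j} → i < j → 0ℤ ≤ j - (1ℤ + i)
  i<j⇒0≤j-[1+i] i<j = i≤j⇒0≤j-i (i<j⇒suc[i]≤j i<j)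

  0≤+ : ∀ {m} → 0ℤ ≤ + m
  0≤+ = +≤+ ℕ.z≤n

  0≤i*j : ∀ {i j} → 0ℤ ≤ i → 0ℤ ≤ j → 0ℤ ≤ i * j
  0≤i*j (+≤+ {n = m} _) (+≤+ {n = k} _) = subst (0ℤ ≤_) (pos-* m k) 0≤+

  _div_ : ℤ → ℕ → ℤ
  y div m = safeDiv y (+ m)

  div-bounds : ∀ y m → 1 ℕ.≤ m → y div m * + m ≤ y × y < (y div m + 1ℤ) * + m
  div-bounds y (suc m) _ =
    ≤-byDifference (+ r) (trans (cong (_- q * + suc m) y≡r+qm) (low (+ r) q (+ suc m))) 0≤+ ,
    <-byDifference (+ m - + r) (trans (cong (λ z → (q + 1ℤ) * + suc m - (1ℤ + z)) y≡r+qm) (high (+ r) q (+ m)))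
      (i≤j⇒0≤j-i (+≤+ (ℕ.≤-pred (n%d<d y (+ suc m)))))
    where
    r = y % + suc m
    q = y / + suc m
    y≡r+qm : y ≡ + r + q * + suc m
    y≡r+qm = a≡a%n+[a/n]*n y (+ suc m)
    low : ∀ r q d → (r + q * d) - q * d ≡ r
    low = solve-∀
    high : ∀ r q m → (q + 1ℤ) * (1ℤ + m) - (1ℤ + (r + q * (1ℤ + m))) ≡ m - r
    high = solve-∀

  div-unique : ∀ y m v → 1 ℕ.≤ m → v * + m ≤ y → y < (v + 1ℤ) * + m → y div m ≡ v
  div-unique y m v 1≤m vm≤y y<[v+1]m = ≤-antisym
    (<+1⇒≤ (*-cancelʳ-<-nonNeg (+ m) (≤-<-trans (proj₁ bounds) y<[v+1]m)))
    (<+1⇒≤ (*-cancelʳ-<-nonNeg (+ m) (≤-<-trans vm≤y (proj₂ bounds))))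
    where
    bounds = div-bounds y m 1≤m
    <+1⇒≤ : ∀ {a b} → a < b + 1ℤ → a ≤ b
    <+1⇒≤ {a} {b} a<b+1 = ≤-byDifference _ (shift b a) (i<j⇒0≤j-[1+i] a<b+1)
      where
      shift : ∀ b a → b - a ≡ b + 1ℤ - (1ℤ + a)
      shift = solve-∀

  div-+-multiple : ∀ y z m → 1 ℕ.≤ m → (y + z * + m) div m ≡ y div m + z
  div-+-multiple y z m 1≤m = div-unique (y + z * + m) m (y div m + z) 1≤m
    (≤-byDifference _ (low y z (+ m) (y div m)) (i≤j⇒0≤j-i (proj₁ bounds)))
    (<-byDifference _ (high y z (+ m) (y div m)) (i<j⇒0≤j-[1+i] (proj₂ bounds)))
    where
    bounds = div-bounds y m 1≤m
    low : ∀ y z m q → (y + z * m) - (q + z) * m ≡ y - q * m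
    low = solve-∀
    high : ∀ y z m q → (q + z + 1ℤ) * m - (1ℤ + (y + z * m)) ≡ (q + 1ℤ) * m - (1ℤ + y)
    high = solve-∀

  div-exact : ∀ {m k} → 1 ℕ.≤ m → (m∣k : m ∣ k) → (+ k) div m ≡ + (_∣_.quotient m∣k)
  div-exact {m} 1≤m (divides q refl) = div-unique (+ (q ℕ.* m)) m (+ q) 1≤m
    (≤-reflexive (sym (pos-* q m)))
    (<-byDifference (+ m - 1ℤ) (trans (cong (λ z → (+ q + 1ℤ) * + m - (1ℤ + z)) (pos-* q m)) (gap (+ q) (+ m)))
      (i≤j⇒0≤j-i (+≤+ 1≤m)))
    where
    gap : ∀ q m → (q + 1ℤ) * m - (1ℤ + q * m) ≡ m - 1ℤ
    gap = solve-∀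

  div-*-exact : ∀ {m k} → 1 ℕ.≤ m → m ∣ k → (+ k) div m * + m ≡ + k
  div-*-exact {m} 1≤m m∣k@(divides q refl) = trans (cong (_* + m) (div-exact 1≤m m∣k)) (sym (pos-* q m))

module Workload {n : ℕ} (c p J : Fin n → ℕ) (p≥1 : ∀ i → 1 ℕ.≤ p i) where
  open import Data.Nat.Divisibility using (_∣_; ∣-refl)
  open import Data.Nat.ListAction using (sum)
  open import Data.Integer using (ℤ; +_; -[1+_]; 0ℤ; 1ℤ; _+_; _-_; _*_; -_; _≤_; _<_; _⊔_; +≤+; -<+; ∣_∣)
  open import Data.Integer.DivMod using (div-pos-is-/ℕ)
  open import Data.Integer.Properties
  open import Data.Integer.Tactic.RingSolver using (solve-∀)
  open import Data.List using (List; []; _∷_; map)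
  open import Data.List.Relation.Unary.All using (All; []; _∷_)
  open import Data.Product using (_×_; _,_; proj₁; proj₂; ∃-syntax)
  open import Data.Sum using (inj₁; inj₂)
  open import Data.Unit using (⊤)
  open import Relation.Nullary using (yes; no)
  open import Relation.Binary.PropositionalEquality hiding (J)
  open import Defs using (ceilDiv)
  open IntegerFloor

  -- ⌈(t + J b) / p b⌉
  arrivals : Fin n → ℤ → ℤ
  arrivals b t = (t + + J b - 1ℤ) div p b + 1ℤ

  arrivals-bounds : ∀ b t → (arrivals b t - 1ℤ) * + p b < t + + J b × t + + J b ≤ arrivals b t * + p b
  arrivals-bounds b t =
    <-byDifference _ (low t (+ J b) q (+ p b)) (i≤j⇒0≤j-i (proj₁ bounds)) ,
    ≤-byDifference _ (high t (+ J b) q (+ p b)) (i<j⇒0≤j-[1+i] (proj₂ bounds))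
    where
    q = (t + + J b - 1ℤ) div p b
    bounds = div-bounds (t + + J b - 1ℤ) (p b) (p≥1 b)
    low : ∀ t j q p → (t + j) - (1ℤ + (q + 1ℤ - 1ℤ) * p) ≡ (t + j - 1ℤ) - q * p
    low = solve-∀
    high : ∀ t j q p → (q + 1ℤ) * p - (t + j) ≡ (q + 1ℤ) * p - (1ℤ + (t + j - 1ℤ))
    high = solve-∀

  arrivals-≤ : ∀ b t w → t + + J b ≤ w * + p b → arrivals b t ≤ w
  arrivals-≤ b t w t+J≤wp = ≤-byDifference _ (shift w (arrivals b t))
    (i<j⇒0≤j-[1+i] (*-cancelʳ-<-nonNeg {arrivals b t - 1ℤ} {w} (+ p b) (<-≤-trans (proj₁ (arrivals-bounds b t)) t+J≤wp)))
    where
    shift : ∀ w u → w - u ≡ w - (1ℤ + (u - 1ℤ))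
    shift = solve-∀

  arrivals-≥ : ∀ b t w → (w - 1ℤ) * + p b < t + + J b → w ≤ arrivals b t
  arrivals-≥ b t w [w-1]p<t+J = ≤-byDifference _ (shift w (arrivals b t))
    (i<j⇒0≤j-[1+i] (*-cancelʳ-<-nonNeg {w - 1ℤ} {arrivals b t} (+ p b) (<-≤-trans [w-1]p<t+J (proj₂ (arrivals-bounds b t)))))
    where
    shift : ∀ w u → u - w ≡ u - (1ℤ + (w - 1ℤ))
    shift = solve-∀

  arrivals-unique : ∀ b t w → (w - 1ℤ) * + p b < t + + J b → t + + J b ≤ w * + p b → arrivals b t ≡ w
  arrivals-unique b t w lower upper = ≤-antisym (arrivals-≤ b t w upper) (arrivals-≥ b t w lower)

  arrivals-mono : ∀ b {t u} → t ≤ u → arrivals b t ≤ arrivals b u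
  arrivals-mono b {t} {u} t≤u =
    arrivals-≤ b t (arrivals b u) (≤-trans (+-monoˡ-≤ (+ J b) t≤u) (proj₂ (arrivals-bounds b u)))

  arrivals-shift : ∀ b t z → arrivals b (t + z * + p b) ≡ arrivals b t + z
  arrivals-shift b t z = arrivals-unique b (t + z * + p b) (arrivals b t + z)
    (<-byDifference _ (low t (+ J b) z (+ p b) (arrivals b t)) (i<j⇒0≤j-[1+i] (proj₁ (arrivals-bounds b t))))
    (≤-byDifference _ (high t (+ J b) z (+ p b) (arrivals b t)) (i≤j⇒0≤j-i (proj₂ (arrivals-bounds b t))))
    where
    low : ∀ t j z p u → (t + z * p) + j - (1ℤ + (u + z - 1ℤ) * p) ≡ t + j - (1ℤ + (u - 1ℤ) * p)
    low = solve-∀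
    high : ∀ t j z p u → (u + z) * p - ((t + z * p) + j) ≡ u * p - (t + j)
    high = solve-∀

  releaseIndex : Fin n → ℤ → ℤ
  releaseIndex a x = (x + + J a) div p a

  -- Jobs of task a are released at the times j * p a - J a; this is the last one not after x.
  lastRelease : Fin n → ℤ → ℤ
  lastRelease a x = releaseIndex a x * + p a - + J a

  releaseIndex-bounds : ∀ a x → lastRelease a x ≤ x × x + + J a < (releaseIndex a x + 1ℤ) * + p a
  releaseIndex-bounds a x =
    ≤-byDifference _ (shift x (releaseIndex a x) (+ p a) (+ J a)) (i≤j⇒0≤j-i (proj₁ bounds)) , proj₂ bounds
    where
    bounds = div-bounds (x + + J a) (p a) (p≥1 a)
    shift : ∀ x v p j → x - (v * p - j) ≡ (x + j) - v * p
    shift = solve-∀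

  arrivals-lastRelease : ∀ a x → arrivals a (lastRelease a x) ≡ releaseIndex a x
  arrivals-lastRelease a x = arrivals-unique a (lastRelease a x) (releaseIndex a x)
    (<-byDifference _ (low (releaseIndex a x) (+ p a) (+ J a)) (i≤j⇒0≤j-i (+≤+ (p≥1 a))))
    (≤-byDifference 0ℤ (high (releaseIndex a x) (+ p a) (+ J a)) ≤-refl)
    where
    low : ∀ v p j → (v * p - j) + j - (1ℤ + (v - 1ℤ) * p) ≡ p - 1ℤ
    low = solve-∀
    high : ∀ v p j → v * p - ((v * p - j) + j) ≡ 0ℤ
    high = solve-∀

  arrivals-≤-lastRelease : ∀ a x t → t ≤ lastRelease a x → arrivals a t ≤ releaseIndex a x
  arrivals-≤-lastRelease a x t t≤e = subst (arrivals a t ≤_) (arrivals-lastRelease a x) (arrivals-mono a t≤e)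

  arrivals-≤-1+releaseIndex : ∀ a x t → t ≤ x → arrivals a t ≤ releaseIndex a x + 1ℤ
  arrivals-≤-1+releaseIndex a x t t≤x =
    arrivals-≤ a t (releaseIndex a x + 1ℤ) (≤-trans (+-monoˡ-≤ (+ J a) t≤x) (<⇒≤ (proj₂ (releaseIndex-bounds a x))))

  arrivals-afterLastRelease : ∀ a x t → lastRelease a x < t → t ≤ x → arrivals a t ≡ releaseIndex a x + 1ℤ
  arrivals-afterLastRelease a x t e<t t≤x = ≤-antisym (arrivals-≤-1+releaseIndex a x t t≤x)
    (arrivals-≥ a t (releaseIndex a x + 1ℤ) (<-byDifference _ (shift t (releaseIndex a x) (+ p a) (+ J a)) (i<j⇒0≤j-[1+i] e<t)))
    where
    shift : ∀ t v p j → t + j - (1ℤ + (v + 1ℤ - 1ℤ) * p) ≡ t - (1ℤ + (v * p - j))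
    shift = solve-∀

  releaseIndex-shift : ∀ a x z → releaseIndex a (x + z * + p a) ≡ releaseIndex a x + z
  releaseIndex-shift a x z =
    trans (cong (_div p a) (swap x (z * + p a) (+ J a))) (div-+-multiple (x + + J a) z (p a) (p≥1 a))
    where
    swap : ∀ x m j → x + m + j ≡ x + j + m
    swap = solve-∀

  lastRelease-shift : ∀ a x z → lastRelease a (x + z * + p a) ≡ lastRelease a x + z * + p a
  lastRelease-shift a x z =
    trans (cong (λ v → v * + p a - + J a) (releaseIndex-shift a x z)) (distrib (releaseIndex a x) z (+ p a) (+ J a))
    where
    distrib : ∀ v z p j → (v + z) * p - j ≡ v * p - j + z * p
    distrib = solve-∀

  workload : List (Fin n) → ℤ → ℤ
  workload [] t = 0ℤ
  workload (b ∷ D) t = + c b * arrivals b t + workload D t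

  slack : List (Fin n) → ℤ → ℤ
  slack D t = t - workload D t

  windowWork : List (Fin n) → ℕ → ℤ
  windowWork [] m = 0ℤ
  windowWork (b ∷ D) m = + c b * ((+ m) div p b) + windowWork D m

  slack-∷ : ∀ a D t → slack (a ∷ D) t ≡ slack D t - + c a * arrivals a t
  slack-∷ a D t = regroup t (+ c a * arrivals a t) (workload D t)
    where
    regroup : ∀ t u w → t - (u + w) ≡ (t - w) - u
    regroup = solve-∀

  minus-work-antitone : ∀ s a {u v} → u ≤ v → s - + c a * v ≤ s - + c a * u
  minus-work-antitone s a {u} {v} u≤v =
    ≤-byDifference _ (difference s (+ c a) u v) (0≤i*j {+ c a} 0≤+ (i≤j⇒0≤j-i u≤v))
    where
    difference : ∀ s c u v → (s - c * u) - (s - c * v) ≡ c * (v - u)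
    difference = solve-∀

  multiple-of-period : ∀ b {m} → p b ∣ m → ∀ z → z * + m ≡ (z * ((+ m) div p b)) * + p b
  multiple-of-period b p∣m z =
    trans (cong (z *_) (sym (div-*-exact (p≥1 b) p∣m))) (sym (*-assoc z ((+ _) div p b) (+ p b)))

  workload-shift : ∀ D m → All (λ b → p b ∣ m) D → ∀ t z →
                   workload D (t + z * + m) ≡ workload D t + z * windowWork D m
  workload-shift [] m [] t z = sym (noWork z)
    where
    noWork : ∀ z → 0ℤ + z * 0ℤ ≡ 0ℤ
    noWork = solve-∀
  workload-shift (b ∷ D) m (p∣m ∷ D∣m) t z = begin
      + c b * arrivals b (t + z * + m) + workload D (t + z * + m)
    ≡⟨ cong₂ (λ u w → + c b * u + w) arrivals-step (workload-shift D m D∣m t z) ⟩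
      + c b * (arrivals b t + z * q) + (workload D t + z * windowWork D m)
    ≡⟨ regroup (+ c b) (arrivals b t) z q (workload D t) (windowWork D m) ⟩
      + c b * arrivals b t + workload D t + z * (+ c b * q + windowWork D m)
    ∎
    where
    open ≡-Reasoning
    q = (+ m) div p b
    arrivals-step : arrivals b (t + z * + m) ≡ arrivals b t + z * q
    arrivals-step = trans (cong (λ s → arrivals b (t + s)) (multiple-of-period b p∣m z)) (arrivals-shift b t (z * q))
    regroup : ∀ c u z q w r → c * (u + z * q) + (w + z * r) ≡ c * u + w + z * (c * q + r)
    regroup = solve-∀

  slack-shift : ∀ D m → All (λ b → p b ∣ m) D → ∀ t z →
                slack D (t + z * + m) ≡ slack D t + z * (+ m - windowWork D m)
  slack-shift D m D∣m t z =
    trans (cong (λ w → t + z * + m - w) (workload-shift D m D∣m t z)) (regroup t (+ m) z (workload D t) (windowWork D m))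
    where
    regroup : ∀ t m z w r → t + z * m - (w + z * r) ≡ t - w + z * (m - r)
    regroup = solve-∀

  Admissible : List (Fin n) → Set
  Admissible [] = ⊤
  Admissible (a ∷ D) = Admissible D × All (λ b → p b ∣ p a) D × windowWork (a ∷ D) (p a) ≤ + p a

  slack-periodic : ∀ a D → Admissible (a ∷ D) → ∀ t {z} → 0ℤ ≤ z → slack (a ∷ D) t ≤ slack (a ∷ D) (t + z * + p a)
  slack-periodic a D (_ , D∣pa , work≤pa) t {z} 0≤z =
    ≤-byDifference _ (trans (cong (_- slack (a ∷ D) t) (slack-shift (a ∷ D) (p a) (∣-refl ∷ D∣pa) t z)) (cancel (slack (a ∷ D) t) _))
      (0≤i*j 0≤z (i≤j⇒0≤j-i work≤pa))
    where
    cancel : ∀ s g → s + g - s ≡ g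
    cancel = solve-∀

  -- For admissible D this is the maximum of slack D over all t ≤ x: the left branch covers the t
  -- up to the last release of a (shifted by whole periods of a, along which slack does not decrease),
  -- the right branch the later t, at which a has one more arrival.
  maxSlack : List (Fin n) → ℤ → ℤ
  maxSlack [] x = x
  maxSlack (a ∷ D) x =
    (maxSlack D (lastRelease a x) - + c a * releaseIndex a x) ⊔
    (maxSlack D x - + c a * (releaseIndex a x + 1ℤ))

  maxSlack-attained : ∀ D x → ∃[ t ] t ≤ x × maxSlack D x ≤ slack D t
  maxSlack-attained [] x = x , ≤-refl , ≤-reflexive (sym (minus-zero x))
    where
    minus-zero : ∀ x → x - 0ℤ ≡ x
    minus-zero = solve-∀
  maxSlack-attained (a ∷ D) x with ⊔-sel (maxSlack D (lastRelease a x) - + c a * releaseIndex a x)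
                                         (maxSlack D x - + c a * (releaseIndex a x + 1ℤ))
  ... | inj₁ takesLeft =
    let (t , t≤e , bound) = maxSlack-attained D (lastRelease a x)
    in t , ≤-trans t≤e (proj₁ (releaseIndex-bounds a x)) , (begin
      maxSlack (a ∷ D) x                                  ≡⟨ takesLeft ⟩
      maxSlack D (lastRelease a x) - + c a * releaseIndex a x ≤⟨ +-monoˡ-≤ _ bound ⟩
      slack D t - + c a * releaseIndex a x                ≤⟨ minus-work-antitone (slack D t) a (arrivals-≤-lastRelease a x t t≤e) ⟩
      slack D t - + c a * arrivals a t                    ≡⟨ slack-∷ a D t ⟨
      slack (a ∷ D) t                                     ∎)
    where open ≤-Reasoning
  ... | inj₂ takesRight =
    let (t , t≤x , bound) = maxSlack-attained D x
    in t , t≤x , (begin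
      maxSlack (a ∷ D) x                                  ≡⟨ takesRight ⟩
      maxSlack D x - + c a * (releaseIndex a x + 1ℤ)      ≤⟨ +-monoˡ-≤ _ bound ⟩
      slack D t - + c a * (releaseIndex a x + 1ℤ)         ≤⟨ minus-work-antitone (slack D t) a (arrivals-≤-1+releaseIndex a x t t≤x) ⟩
      slack D t - + c a * arrivals a t                    ≡⟨ slack-∷ a D t ⟨
      slack (a ∷ D) t                                     ∎)
    where open ≤-Reasoning

  catchUp : ∀ a x t → t ≤ lastRelease a x →
            ∃[ z ] 0ℤ ≤ z × t + z * + p a ≤ lastRelease a x × arrivals a (t + z * + p a) ≡ releaseIndex a x
  catchUp a x t t≤e = z , i≤j⇒0≤j-i (arrivals-≤-lastRelease a x t t≤e) , t′≤e , arrivals-t′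
    where
    z = releaseIndex a x - arrivals a t
    t′ = t + z * + p a
    arrivals-t′ : arrivals a t′ ≡ releaseIndex a x
    arrivals-t′ = trans (arrivals-shift a t z) (cancel (arrivals a t) (releaseIndex a x))
      where
      cancel : ∀ u v → u + (v - u) ≡ v
      cancel = solve-∀
    t′≤e : t′ ≤ lastRelease a x
    t′≤e = ≤-byDifference _ (shift t′ (+ J a) (releaseIndex a x) (+ p a))
      (i≤j⇒0≤j-i (subst (λ u → t′ + + J a ≤ u * + p a) arrivals-t′ (proj₂ (arrivals-bounds a t′))))
      where
      shift : ∀ t j v p → (v * p - j) - t ≡ v * p - (t + j)
      shift = solve-∀

  slack≤maxSlack : ∀ D → Admissible D → ∀ {x t} → t ≤ x → slack D t ≤ maxSlack D x
  slack≤maxSlack [] _ {x} {t} t≤x = ≤-byDifference _ (minus-zero x t) (i≤j⇒0≤j-i t≤x)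
    where
    minus-zero : ∀ x t → x - (t - 0ℤ) ≡ x - t
    minus-zero = solve-∀
  slack≤maxSlack (a ∷ D) adm@(admD , _ , _) {x} {t} t≤x with t ≤? lastRelease a x
  ... | no t≰e = begin
      slack (a ∷ D) t                                   ≡⟨ slack-∷ a D t ⟩
      slack D t - + c a * arrivals a t                  ≡⟨ cong (λ u → slack D t - + c a * u) (arrivals-afterLastRelease a x t (≰⇒> t≰e) t≤x) ⟩
      slack D t - + c a * (releaseIndex a x + 1ℤ)       ≤⟨ +-monoˡ-≤ _ (slack≤maxSlack D admD t≤x) ⟩
      maxSlack D x - + c a * (releaseIndex a x + 1ℤ)    ≤⟨ i≤j⊔i _ _ ⟩
      maxSlack (a ∷ D) x                                ∎
    where open ≤-Reasoning
  ... | yes t≤e =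
    let (z , 0≤z , t′≤e , arrivals-t′) = catchUp a x t t≤e
        t′ = t + z * + p a
    in begin
      slack (a ∷ D) t                                   ≤⟨ slack-periodic a D adm t 0≤z ⟩
      slack (a ∷ D) t′                                  ≡⟨ slack-∷ a D t′ ⟩
      slack D t′ - + c a * arrivals a t′                ≡⟨ cong (λ u → slack D t′ - + c a * u) arrivals-t′ ⟩
      slack D t′ - + c a * releaseIndex a x             ≤⟨ +-monoˡ-≤ _ (slack≤maxSlack D admD t′≤e) ⟩
      maxSlack D (lastRelease a x) - + c a * releaseIndex a x ≤⟨ i≤i⊔j _ _ ⟩
      maxSlack (a ∷ D) x                                ∎
    where open ≤-Reasoning

  maxSlack-shift : ∀ D m → All (λ b → p b ∣ m) D → ∀ x z →
                   maxSlack D (x + z * + m) ≡ maxSlack D x + z * (+ m - windowWork D m)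
  maxSlack-shift [] m [] x z = shift x z (+ m)
    where
    shift : ∀ x z m → x + z * m ≡ x + z * (m - 0ℤ)
    shift = solve-∀
  maxSlack-shift (a ∷ D) m (p∣m ∷ D∣m) x z = begin
      (maxSlack D (lastRelease a x′) - + c a * releaseIndex a x′) ⊔ (maxSlack D x′ - + c a * (releaseIndex a x′ + 1ℤ))
    ≡⟨ cong₂ (λ e v → (maxSlack D e - + c a * v) ⊔ (maxSlack D x′ - + c a * (v + 1ℤ))) lastRelease-x′ releaseIndex-x′ ⟩
      (maxSlack D (lastRelease a x + z * + m) - + c a * (v + z * q)) ⊔ (maxSlack D x′ - + c a * (v + z * q + 1ℤ))
    ≡⟨ cong₂ (λ l r → (l - + c a * (v + z * q)) ⊔ (r - + c a * (v + z * q + 1ℤ)))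
             (maxSlack-shift D m D∣m (lastRelease a x) z) (maxSlack-shift D m D∣m x z) ⟩
      (maxSlack D (lastRelease a x) + z * K - + c a * (v + z * q)) ⊔ (maxSlack D x + z * K - + c a * (v + z * q + 1ℤ))
    ≡⟨ cong₂ _⊔_ (regroup (maxSlack D (lastRelease a x)) z (+ m) (windowWork D m) (+ c a) v q)
                 (regroup+1 (maxSlack D x) z (+ m) (windowWork D m) (+ c a) v q) ⟩
      (maxSlack D (lastRelease a x) - + c a * v + z * K′) ⊔ (maxSlack D x - + c a * (v + 1ℤ) + z * K′)
    ≡⟨ mono-≤-distrib-⊔ (+-monoˡ-≤ (z * K′)) (maxSlack D (lastRelease a x) - + c a * v) (maxSlack D x - + c a * (v + 1ℤ)) ⟨
      maxSlack (a ∷ D) x + z * K′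
    ∎
    where
    open ≡-Reasoning
    x′ = x + z * + m
    v = releaseIndex a x
    q = (+ m) div p a
    K = + m - windowWork D m
    K′ = + m - windowWork (a ∷ D) m
    releaseIndex-x′ : releaseIndex a x′ ≡ v + z * q
    releaseIndex-x′ = trans (cong (λ s → releaseIndex a (x + s)) (multiple-of-period a p∣m z)) (releaseIndex-shift a x (z * q))
    lastRelease-x′ : lastRelease a x′ ≡ lastRelease a x + z * + m
    lastRelease-x′ = trans (cong (λ s → lastRelease a (x + s)) (multiple-of-period a p∣m z))
      (trans (lastRelease-shift a x (z * q)) (cong (λ s → lastRelease a x + s) (sym (multiple-of-period a p∣m z))))
    regroup : ∀ s z m w c v q → s + z * (m - w) - c * (v + z * q) ≡ s - c * v + z * (m - (c * q + w))
    regroup = solve-∀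
    regroup+1 : ∀ s z m w c v q → s + z * (m - w) - c * (v + z * q + 1ℤ) ≡ s - c * (v + 1ℤ) + z * (m - (c * q + w))
    regroup+1 = solve-∀

  -- A negative time is moved by whole periods of the first task into [0, p a) ⊆ [0, k].
  slack-from-nonNegative : ∀ {k} D → Admissible D → All (λ a → p a ℕ.≤ k) D → ∀ t → t ≤ + k →
                           ∃[ t′ ] t′ ℕ.≤ k × slack D t ≤ slack D (+ t′)
  slack-from-nonNegative D _ _ (+ t) t≤k = t , drop‿+≤+ t≤k , ≤-refl
  slack-from-nonNegative [] _ _ -[1+ j ] _ = 0 , ℕ.z≤n , ≤-byDifference _ (difference j) 0≤+
    where
    difference : ∀ j → 0ℤ - 0ℤ - (-[1+ j ] - 0ℤ) ≡ + ℕ.suc j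
    difference j = refl
  slack-from-nonNegative {k} (a ∷ X) adm (pa≤k ∷ _) t@(-[1+ j ]) _ =
    ∣ t′ ∣ , ℕP.≤-trans (ℕP.<⇒≤ (drop‿+<+ (subst (_< + p a) t′≡+∣t′∣ t′<pa))) pa≤k ,
    ≤-trans (slack-periodic a X adm t 0≤z) (≤-reflexive (cong (slack (a ∷ X)) t′≡+∣t′∣))
    where
    bounds = div-bounds t (p a) (p≥1 a)
    z = - (t div p a)
    t′ = t + z * + p a
    t′≡t-qp : t′ ≡ t - t div p a * + p a
    t′≡t-qp = negate-out t (t div p a) (+ p a)
      where
      negate-out : ∀ t q p → t + (- q) * p ≡ t - q * p
      negate-out = solve-∀
    q<0 : t div p a < 0ℤ
    q<0 = *-cancelʳ-<-nonNeg {t div p a} {0ℤ} (+ p a)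
            (≤-<-trans (proj₁ bounds) (<-≤-trans -<+ (≤-reflexive (sym (*-zeroˡ (+ p a))))))
    0≤z : 0ℤ ≤ z
    0≤z = neg-mono-≤ (<⇒≤ q<0)
    t′≡+∣t′∣ : t′ ≡ + ∣ t′ ∣
    t′≡+∣t′∣ = sym (0≤i⇒+∣i∣≡i (subst (0ℤ ≤_) (sym t′≡t-qp) (i≤j⇒0≤j-i (proj₁ bounds))))
    t′<pa : t′ < + p a
    t′<pa = subst (_< + p a) (sym t′≡t-qp) (<-byDifference _ (shift t (t div p a) (+ p a)) (i<j⇒0≤j-[1+i] (proj₂ bounds)))
      where
      shift : ∀ t q p → p - (1ℤ + (t - q * p)) ≡ (q + 1ℤ) * p - (1ℤ + t)
      shift = solve-∀

  arrivals-ceilDiv : ∀ b t → arrivals b (+ t) ≡ + ceilDiv (t ℕ.+ J b) (p b)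
  arrivals-ceilDiv b t = helper (p b) (p≥1 b)
    where
    helper : ∀ m → 1 ℕ.≤ m → (+ t + + J b - 1ℤ) div m + 1ℤ ≡ + ceilDiv (t ℕ.+ J b) m
    helper (ℕ.suc q) 1≤m = begin
        (+ t + + J b - 1ℤ) div ℕ.suc q + 1ℤ
      ≡⟨ cong (λ y → y div ℕ.suc q + 1ℤ) (borrow (+ t) (+ J b) (+ q)) ⟩
        (+ (t ℕ.+ J b ℕ.+ q) + - 1ℤ * + ℕ.suc q) div ℕ.suc q + 1ℤ
      ≡⟨ cong (_+ 1ℤ) (div-+-multiple (+ (t ℕ.+ J b ℕ.+ q)) (- 1ℤ) (ℕ.suc q) 1≤m) ⟩
        (+ (t ℕ.+ J b ℕ.+ q)) div ℕ.suc q - 1ℤ + 1ℤ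
      ≡⟨ cancel ((+ (t ℕ.+ J b ℕ.+ q)) div ℕ.suc q) ⟩
        (+ (t ℕ.+ J b ℕ.+ q)) div ℕ.suc q
      ≡⟨ div-pos-is-/ℕ (+ (t ℕ.+ J b ℕ.+ q)) (ℕ.suc q) ⟩
        + ceilDiv (t ℕ.+ J b) (ℕ.suc q)
      ∎
      where
      open ≡-Reasoning
      borrow : ∀ t j q → t + j - 1ℤ ≡ (t + j + q) + - 1ℤ * (1ℤ + q)
      borrow = solve-∀
      cancel : ∀ x → x - 1ℤ + 1ℤ ≡ x
      cancel = solve-∀

  workload-ceilDiv : ∀ D t → workload D (+ t) ≡ + sum (map (λ b → c b ℕ.* ceilDiv (t ℕ.+ J b) (p b)) D)
  workload-ceilDiv [] t = refl
  workload-ceilDiv (b ∷ D) t =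
    trans (cong₂ (λ u w → + c b * u + w) (arrivals-ceilDiv b t) (workload-ceilDiv D t))
          (cong (_+ + sum (map (λ b → c b ℕ.* ceilDiv (t ℕ.+ J b) (p b)) D)) (sym (pos-* (c b) _)))

module Yielding where
  open import Data.Product using (_×_; _,_; proj₁; proj₂)
  open import Data.Integer using (ℤ)
  open import Relation.Binary.PropositionalEquality
  open import Defs using (Prog; run; lit; arith; evalOp)

  Yields : {A : Set} → ((A → Prog ℤ) → Prog ℤ) → A → ℕ → Set
  Yields m a N = ∀ k → proj₁ (run (m k)) ≡ proj₁ (run (k a)) × proj₂ (run (m k)) ℕ.≤ N ℕ.+ proj₂ (run (k a))

  yields-return : ∀ {A : Set} (a : A) → Yields (λ k → k a) a 0
  yields-return a k = refl , ℕP.≤-refl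

  yields-bind : ∀ {A B : Set} {m : (A → Prog ℤ) → Prog ℤ} {a : A} {N} {f : A → (B → Prog ℤ) → Prog ℤ} {b : B} {M} →
                Yields m a N → Yields (f a) b M → Yields (λ k → m (λ x → f x k)) b (N ℕ.+ M)
  yields-bind {N = N} {M = M} m-yields f-yields k =
    trans (proj₁ (m-yields _)) (proj₁ (f-yields k)) ,
    ℕP.≤-trans (proj₂ (m-yields _))
      (ℕP.≤-trans (ℕP.+-monoʳ-≤ N (proj₂ (f-yields k))) (ℕP.≤-reflexive (sym (ℕP.+-assoc N M _))))

  yields-map : ∀ {A B : Set} {m : (A → Prog ℤ) → Prog ℤ} {a : A} {N} (g : A → B) →
               Yields m a N → Yields (λ k → m (λ x → k (g x))) (g a) N
  yields-map g m-yields k = m-yields (λ x → k (g x))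

  yields-≤ : ∀ {A : Set} {m : (A → Prog ℤ) → Prog ℤ} {a : A} {N N′} → N ℕ.≤ N′ → Yields m a N → Yields m a N′
  yields-≤ N≤N′ m-yields k = proj₁ (m-yields k) , ℕP.≤-trans (proj₂ (m-yields k)) (ℕP.+-monoˡ-≤ _ N≤N′)

  yields-lit : ∀ {A : Set} z {f : ℤ → (A → Prog ℤ) → Prog ℤ} {a : A} {N} →
               Yields (f z) a N → Yields (λ k → lit z (λ r → f r k)) a (ℕ.suc N)
  yields-lit z f-yields k = proj₁ (f-yields k) , ℕ.s≤s (proj₂ (f-yields k))

  yields-arith : ∀ {A : Set} o x y {f : ℤ → (A → Prog ℤ) → Prog ℤ} {a : A} {N} →
                 Yields (f (evalOp o x y)) a N → Yields (λ k → arith o x y (λ r → f r k)) a (ℕ.suc N)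
  yields-arith o x y f-yields k = proj₁ (f-yields k) , ℕ.s≤s (proj₂ (f-yields k))

  yields-≡ : ∀ {A : Set} {m : (A → Prog ℤ) → Prog ℤ} {a a′ : A} {N} → a ≡ a′ → Yields m a N → Yields m a′ N
  yields-≡ refl m-yields = m-yields

module Programs {V : Set} {n : ℕ} (cV pV JV : Fin n → V) where
  open import Data.Bool using (false; if_then_else_)
  open import Data.List using (List; []; _∷_)
  open import Data.Integer using (0ℤ)
  open import Defs using (Prog; done; lit; arith; leq; add; sub; mul; quot)

  insertByPeriod : Fin n → List (Fin n) → (List (Fin n) → Prog V) → Prog V
  insertByPeriod x [] k = k (x ∷ [])
  insertByPeriod x (y ∷ ys) k =
    leq (pV y) (pV x) λ b → if b then k (x ∷ y ∷ ys) else insertByPeriod x ys (λ r → k (y ∷ r))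

  sortByPeriod : List (Fin n) → (List (Fin n) → Prog V) → Prog V
  sortByPeriod [] k = k []
  sortByPeriod (x ∷ xs) k = sortByPeriod xs (λ r → insertByPeriod x r k)

  subtractWindowWork : Fin n → V → List (Fin n) → (V → Prog V) → Prog V
  subtractWindowWork a acc [] k = k acc
  subtractWindowWork a acc (b ∷ D) k =
    arith quot (pV a) (pV b) λ q → arith mul (cV b) q λ w → arith sub acc w λ acc′ → subtractWindowWork a acc′ D k

  maxSlackStep : Fin n → V → V → V → V → (V → Prog V) → Prog V
  maxSlackStep a gain w₀ x wx k =
    arith add x (JV a) λ s → arith quot s (pV a) λ v → arith mul v gain λ vg → arith add w₀ vg λ left →
    arith mul (cV a) v λ cv → arith sub wx cv λ r → arith sub r (cV a) λ right →
    leq left right λ b → k (if b then right else left)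

  maxSlackSteps : Fin n → V → V → List V → List V → (List V → Prog V) → Prog V
  maxSlackSteps a gain w₀ (x ∷ xs) (wx ∷ ws) k =
    maxSlackStep a gain w₀ x wx λ r → maxSlackSteps a gain w₀ xs ws λ rs → k (r ∷ rs)
  maxSlackSteps a gain w₀ _ _ k = k []

  atLeast : V → List V → Prog V
  atLeast γ [] = done false
  atLeast γ (w ∷ _) = leq γ w done

  addTask : Fin n → List (Fin n) → List V → (List V → Prog V) → List V → Prog V
  addTask a D xs k [] = done false  -- unreachable: maxSlackAt returns one value per point
  addTask a D xs k (w₀ ∷ ws) =
    arith sub (pV a) (cV a) λ acc → subtractWindowWork a acc D λ gain → maxSlackSteps a gain w₀ xs ws k

  -- Besides the query points xs, maxSlack D is only evaluated at - J a: by maxSlack-shift its value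
  -- at lastRelease a x is read off from there, so every task adds a single point.
  maxSlackAt : List V → List (Fin n) → (List V → Prog V) → Prog V
  maxSlackAt xs [] k = k xs
  maxSlackAt xs (a ∷ D) k = lit 0ℤ λ z₀ → arith sub z₀ (JV a) λ -Ja → maxSlackAt (-Ja ∷ xs) D (addTask a D xs k)

module ProgramSpec {n : ℕ} (c p J : Fin n → ℕ) (p≥1 : ∀ i → 1 ℕ.≤ p i) where
  open import Data.Bool using (true; false; if_then_else_; T)
  open import Data.Nat.Divisibility using (_∣_)
  open import Data.Nat.Tactic.RingSolver using () renaming (solve-∀ to ℕ-solve-∀)
  open import Data.Integer using (ℤ; +_; 0ℤ; 1ℤ; _+_; _-_; _*_; _⊔_; _≤ᵇ_)
  open import Data.Integer.Properties
  open import Data.Integer.Tactic.RingSolver using (solve-∀)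
  open import Data.List using (List; []; _∷_; length; map)
  open import Data.List.Properties using (map-id)
  open import Data.List.Relation.Unary.All using (All)
  open import Data.List.Relation.Binary.Permutation.Propositional.Properties using (↭-length)
  import Data.List.Sort.InsertionSort.Base as InsertionSort
  import Data.List.Sort.InsertionSort.Properties as InsertionSortProperties
  open import Data.Product using (_,_)
  open import Data.Unit using (tt)
  open import Relation.Binary.Bundles using (DecTotalOrder)
  import Relation.Binary.Construct.On as On
  import Relation.Binary.Construct.Flip.EqAndOrd as Flip
  open import Relation.Binary.PropositionalEquality hiding (J)
  open import Defs using (sub; arith)
  open IntegerFloor using (_div_)
  open Yielding
  open Workload c p J p≥1
  open Programs {ℤ} (λ i → + c i) (λ i → + p i) (λ i → + J i)

  byDecreasingPeriod : DecTotalOrder _ _ _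
  byDecreasingPeriod = On.decTotalOrder (Flip.decTotalOrder ℕP.≤-decTotalOrder) p

  open InsertionSort byDecreasingPeriod using (insert; sort)
  open InsertionSortProperties byDecreasingPeriod using (sort-↭)

  insertByPeriod-yields : ∀ x ys → Yields (insertByPeriod x ys) (insert x ys) (length ys)
  insertByPeriod-yields x [] k = refl , ℕP.≤-refl
  insertByPeriod-yields x (y ∷ ys) k with p y ℕ.≤ᵇ p x
  ... | true = refl , ℕ.s≤s (ℕP.m≤n+m _ _)
  ... | false = let (same , cheap) = insertByPeriod-yields x ys (λ r → k (y ∷ r)) in same , ℕ.s≤s cheap

  sortByPeriod-yields : ∀ xs → Yields (sortByPeriod xs) (sort xs) (length xs ℕ.* length xs)
  sortByPeriod-yields [] = yields-return []
  sortByPeriod-yields (x ∷ xs) =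
    yields-≤ {m = sortByPeriod (x ∷ xs)} bound
      (yields-bind {m = sortByPeriod xs} {f = insertByPeriod x} (sortByPeriod-yields xs) (insertByPeriod-yields x (sort xs)))
    where
    L = length xs
    bound : L ℕ.* L ℕ.+ length (sort xs) ℕ.≤ ℕ.suc L ℕ.* ℕ.suc L
    bound rewrite ↭-length (sort-↭ xs) = ℕP.≤-trans (ℕP.m≤m+n (L ℕ.* L ℕ.+ L) (ℕ.suc L)) (ℕP.≤-reflexive (square L))
      where
      square : ∀ L → L ℕ.* L ℕ.+ L ℕ.+ ℕ.suc L ≡ ℕ.suc L ℕ.* ℕ.suc L
      square = ℕ-solve-∀

  if≤ᵇ≡⊔ : ∀ i j → (if i ≤ᵇ j then j else i) ≡ i ⊔ j
  if≤ᵇ≡⊔ i j with i ≤ᵇ j in eq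
  ... | true = sym (i≤j⇒i⊔j≡j (≤ᵇ⇒≤ (subst T (sym eq) tt)))
  ... | false = sym (i≥j⇒i⊔j≡i (<⇒≤ (≰⇒> (λ i≤j → subst T eq (≤⇒≤ᵇ i≤j)))))

  subtractWindowWork-yields : ∀ a acc D → Yields (subtractWindowWork a acc D) (acc - windowWork D (p a)) (length D ℕ.* 3)
  subtractWindowWork-yields a acc [] = yields-≡ {m = subtractWindowWork a acc []} (sym (minus-zero acc)) (yields-return acc)
    where
    minus-zero : ∀ a → a - 0ℤ ≡ a
    minus-zero = solve-∀
  subtractWindowWork-yields a acc (b ∷ D) =
    yields-≡ {m = subtractWindowWork a acc (b ∷ D)} (regroup acc (+ c b) ((+ p a) div p b) (windowWork D (p a)))
      (λ k → let (same , cheap) = subtractWindowWork-yields a (acc - + c b * ((+ p a) div p b)) D k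
             in same , ℕ.s≤s (ℕ.s≤s (ℕ.s≤s cheap)))
    where
    regroup : ∀ a c q r → a - c * q - r ≡ a - (c * q + r)
    regroup = solve-∀

  -- p a - windowWork (a ∷ D) (p a), in the form the program computes it
  periodGain : Fin n → List (Fin n) → ℤ
  periodGain a D = + p a - + c a - windowWork D (p a)

  maxSlackStep-yields : ∀ a D → All (λ b → p b ∣ p a) D → ∀ x →
    Yields (maxSlackStep a (periodGain a D) (maxSlack D (0ℤ - + J a)) x (maxSlack D x))
           (maxSlack (a ∷ D) x) 8
  maxSlackStep-yields a D D∣pa x =
    yields-≡ {m = maxSlackStep a gain w₀ x (maxSlack D x)}
      (trans (if≤ᵇ≡⊔ _ _) (cong₂ _⊔_ left≡ (regroup (maxSlack D x) (+ c a) v))) (λ k → refl , ℕP.≤-refl)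
    where
    open ≡-Reasoning
    v = releaseIndex a x
    gain = periodGain a D
    w₀ = maxSlack D (0ℤ - + J a)
    left≡ : w₀ + v * gain ≡ maxSlack D (lastRelease a x) - + c a * v
    left≡ = sym (begin
        maxSlack D (lastRelease a x) - + c a * v
      ≡⟨ cong (λ y → maxSlack D y - + c a * v) (reorder v (+ p a) (+ J a)) ⟩
        maxSlack D ((0ℤ - + J a) + v * + p a) - + c a * v
      ≡⟨ cong (_- + c a * v) (maxSlack-shift D (p a) D∣pa (0ℤ - + J a) v) ⟩
        w₀ + v * (+ p a - windowWork D (p a)) - + c a * v
      ≡⟨ distribute w₀ v (+ p a) (windowWork D (p a)) (+ c a) ⟩
        w₀ + v * gain
      ∎)
      where
      reorder : ∀ v p j → v * p - j ≡ (0ℤ - j) + v * p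
      reorder = solve-∀
      distribute : ∀ w v p r c → w + v * (p - r) - c * v ≡ w + v * (p - c - r)
      distribute = solve-∀
    regroup : ∀ s c v → s - c * v - c ≡ s - c * (v + 1ℤ)
    regroup = solve-∀

  maxSlackSteps-yields : ∀ a D → All (λ b → p b ∣ p a) D → ∀ xs →
    Yields (maxSlackSteps a (periodGain a D) (maxSlack D (0ℤ - + J a)) xs (map (maxSlack D) xs))
           (map (maxSlack (a ∷ D)) xs) (length xs ℕ.* 8)
  maxSlackSteps-yields a D D∣pa [] = yields-return []
  maxSlackSteps-yields a D D∣pa (x ∷ xs) =
    yields-bind {m = maxSlackStep a (periodGain a D) (maxSlack D (0ℤ - + J a)) x (maxSlack D x)}
                {f = λ r k → maxSlackSteps a (periodGain a D) (maxSlack D (0ℤ - + J a)) xs (map (maxSlack D) xs) (λ rs → k (r ∷ rs))}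
      (maxSlackStep-yields a D D∣pa x)
      (yields-map {m = maxSlackSteps a (periodGain a D) (maxSlack D (0ℤ - + J a)) xs (map (maxSlack D) xs)}
        (maxSlack (a ∷ D) x ∷_) (maxSlackSteps-yields a D D∣pa xs))

  addTask-yields : ∀ a D → All (λ b → p b ∣ p a) D → ∀ xs →
    Yields (λ k → addTask a D xs k (map (maxSlack D) (0ℤ - + J a ∷ xs)))
           (map (maxSlack (a ∷ D)) xs) (1 ℕ.+ (length D ℕ.* 3 ℕ.+ length xs ℕ.* 8))
  addTask-yields a D D∣pa xs =
    yields-arith sub (+ p a) (+ c a)
      {f = λ acc k → subtractWindowWork a acc D (λ gain → maxSlackSteps a gain (maxSlack D (0ℤ - + J a)) xs (map (maxSlack D) xs) k)}
      (yields-bind {m = subtractWindowWork a (+ p a - + c a) D}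
                   {f = λ gain k → maxSlackSteps a gain (maxSlack D (0ℤ - + J a)) xs (map (maxSlack D) xs) k}
        (subtractWindowWork-yields a (+ p a - + c a) D) (maxSlackSteps-yields a D D∣pa xs))

  maxSlackCost : ℕ → ℕ → ℕ
  maxSlackCost β ℕ.zero = 0
  maxSlackCost β (ℕ.suc m) = 2 ℕ.+ (maxSlackCost (ℕ.suc β) m ℕ.+ (1 ℕ.+ (m ℕ.* 3 ℕ.+ β ℕ.* 8)))

  maxSlackAt-yields : ∀ D → Admissible D → ∀ xs → Yields (maxSlackAt xs D) (map (maxSlack D) xs) (maxSlackCost (length xs) (length D))
  maxSlackAt-yields [] _ xs = yields-≡ {m = maxSlackAt xs []} (sym (map-id xs)) (yields-return xs)
  maxSlackAt-yields (a ∷ D) (admD , D∣pa , _) xs =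
    yields-lit 0ℤ {f = λ z k → arith sub z (+ J a) (λ r → maxSlackAt (r ∷ xs) D (addTask a D xs k))}
      (yields-arith sub 0ℤ (+ J a) {f = λ r k → maxSlackAt (r ∷ xs) D (addTask a D xs k)}
      (yields-bind {m = maxSlackAt (0ℤ - + J a ∷ xs) D} {f = λ ws k → addTask a D xs k ws}
        (maxSlackAt-yields D admD (0ℤ - + J a ∷ xs)) (addTask-yields a D D∣pa xs)))

  maxSlackCost-bound : ∀ β m → maxSlackCost β m ℕ.≤ 11 ℕ.* (m ℕ.* (m ℕ.+ β))
  maxSlackCost-bound β ℕ.zero = ℕ.z≤n
  maxSlackCost-bound β (ℕ.suc m) =
    ℕP.≤-trans (ℕP.+-monoʳ-≤ 2 (ℕP.+-monoˡ-≤ (1 ℕ.+ (m ℕ.* 3 ℕ.+ β ℕ.* 8)) (maxSlackCost-bound (ℕ.suc β) m)))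
      (ℕP.≤-trans (ℕP.m≤m+n _ (8 ℕ.* m ℕ.+ 3 ℕ.* β ℕ.+ 8)) (ℕP.≤-reflexive (expand β m)))
    where
    expand : ∀ β m → 2 ℕ.+ (11 ℕ.* (m ℕ.* (m ℕ.+ ℕ.suc β)) ℕ.+ (1 ℕ.+ (m ℕ.* 3 ℕ.+ β ℕ.* 8))) ℕ.+ (8 ℕ.* m ℕ.+ 3 ℕ.* β ℕ.+ 8)
                   ≡ 11 ℕ.* (ℕ.suc m ℕ.* (ℕ.suc m ℕ.+ β))
    expand = ℕ-solve-∀

module Utilization {n : ℕ} (c p : Fin n → ℕ) (p≥1 : ∀ i → 1 ℕ.≤ p i) where
  open import Data.Bool using (true; false; if_then_else_)
  open import Data.Nat.Divisibility using (_∣_; divides)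
  open import Data.Nat.ListAction using (sum; product)
  open import Data.Nat.ListAction.Properties using (∈⇒∣product)
  open import Data.Nat.Tactic.RingSolver using () renaming (solve-∀ to ℕ-solve-∀)
  open import Data.Integer using (+_; 0ℤ; _+_; _-_; _*_; _≤_; _<_; +<+)
  open import Data.Integer.Base using (positive)
  open import Data.Integer.Properties
  open import Data.Integer.Tactic.RingSolver using (solve-∀)
  open import Data.Fin using (toℕ)
  open import Data.Fin.Subset using (Subset; _∈_)
  open import Data.List using (List; []; _∷_; map; allFin)
  import Data.List.Membership.Propositional.Properties as Membership
  open import Data.Rational.Unnormalised as Q using (ℚᵘ; mkℚᵘ; 0ℚᵘ; 1ℚᵘ; ↥_; ↧_; *<*)
  import Data.Vec.Properties as Vec
  open import Relation.Binary.PropositionalEquality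
  open import Defs using (frac; utilLower; lookupB; Lower)
  open IntegerFloor using (≤-byDifference; 0≤+; 0≤i*j)

  M : ℕ
  M = product (map p (allFin n))

  M≥1 : 1 ℕ.≤ M
  M≥1 = product≥1 (allFin n)
    where
    product≥1 : ∀ xs → 1 ℕ.≤ product (map p xs)
    product≥1 [] = ℕP.≤-refl
    product≥1 (x ∷ xs) = ℕP.*-mono-≤ (p≥1 x) (product≥1 xs)

  p∣M : ∀ i → p i ∣ M
  p∣M i = ∈⇒∣product (Membership.∈-map⁺ p (Membership.∈-allFin i))

  share : Fin n → ℕ
  share i = _∣_.quotient (p∣M i)

  M≡share*p : ∀ i → M ≡ share i ℕ.* p i
  M≡share*p i = _∣_.equality (p∣M i)

  share-ratio : ∀ a b {w} → p a ≡ w ℕ.* p b → share a ℕ.* w ≡ share b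
  share-ratio a b {w} pa≡wpb = ℕP.*-cancelʳ-≡ _ _ (p b) {{ℕ.>-nonZero (p≥1 b)}} (begin
      share a ℕ.* w ℕ.* p b   ≡⟨ ℕP.*-assoc (share a) w (p b) ⟩
      share a ℕ.* (w ℕ.* p b) ≡⟨ cong (share a ℕ.*_) pa≡wpb ⟨
      share a ℕ.* p a         ≡⟨ M≡share*p a ⟨
      M                       ≡⟨ M≡share*p b ⟩
      share b ℕ.* p b         ∎)
    where open ≡-Reasoning

  -- H ≤ M q, cross-multiplied
  infix 4 _≤M·_
  _≤M·_ : ℕ → ℚᵘ → Set
  H ≤M· q = + H * ↧ q ≤ + M * ↥ q

  ≤M·-+ : ∀ {h H} q r → h ≤M· q → H ≤M· r → (h ℕ.+ H) ≤M· (q Q.+ r)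
  ≤M·-+ {h} {H} (mkℚᵘ a d₁) (mkℚᵘ b d₂) h≤Mq H≤Mr =
    subst (λ z → + (h ℕ.+ H) * z ≤ + M * (a * + ℕ.suc d₂ + b * + ℕ.suc d₁)) (sym (pos-* (ℕ.suc d₁) (ℕ.suc d₂)))
      (≤-byDifference _ (expand (+ h) (+ H) (+ M) a b (+ ℕ.suc d₁) (+ ℕ.suc d₂))
        (+-mono-≤ (0≤i*j {+ ℕ.suc d₂} 0≤+ (i≤j⇒0≤j-i h≤Mq)) (0≤i*j {+ ℕ.suc d₁} 0≤+ (i≤j⇒0≤j-i H≤Mr))))
    where
    expand : ∀ h H M a b s₁ s₂ →
             M * (a * s₂ + b * s₁) - (h + H) * (s₁ * s₂) ≡ s₂ * (M * a - h * s₁) + s₁ * (M * b - H * s₂)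
    expand = solve-∀

  0≤M·nonNegative : ∀ q → 0ℤ ≤ ↥ q → 0 ≤M· q
  0≤M·nonNegative q 0≤q = subst (_≤ + M * ↥ q) (sym (*-zeroˡ (↧ q))) (0≤i*j {+ M} {↥ q} 0≤+ 0≤q)

  ≤M·-frac : ∀ x {m} (m∣M : m ∣ M) → 1 ℕ.≤ m → x ℕ.* _∣_.quotient m∣M ≤M· frac x m
  ≤M·-frac x {ℕ.suc m} (divides u M≡u*m) _ = ≤-reflexive (begin
      + (x ℕ.* u) * + ℕ.suc m   ≡⟨ pos-* (x ℕ.* u) (ℕ.suc m) ⟨
      + (x ℕ.* u ℕ.* ℕ.suc m)   ≡⟨ cong +_ (swap x u (ℕ.suc m)) ⟩
      + (u ℕ.* ℕ.suc m ℕ.* x)   ≡⟨ cong (λ y → + (y ℕ.* x)) M≡u*m ⟨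
      + (M ℕ.* x)               ≡⟨ pos-* M x ⟩
      + M * + x                 ∎)
    where
    open ≡-Reasoning
    swap : ∀ x u s → x ℕ.* u ℕ.* s ≡ u ℕ.* s ℕ.* x
    swap = ℕ-solve-∀

  ≤M·-<1 : ∀ {H} q → H ≤M· q → q Q.< 1ℚᵘ → H ℕ.< M
  ≤M·-<1 {H} (mkℚᵘ a d) H≤Mq (*<* a*1<1*d) = drop‿+<+ (*-cancelʳ-<-nonNeg (+ ℕ.suc d) (≤-<-trans H≤Mq Ma<Md))
    where
    a<d : a < + ℕ.suc d
    a<d = subst₂ _<_ (*-identityʳ a) (*-identityˡ (+ ℕ.suc d)) a*1<1*d
    Ma<Md : + M * a < + M * + ℕ.suc d
    Ma<Md = *-monoˡ-<-pos (+ M) {{positive (+<+ M≥1)}} a<d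

  frac-nonNeg : ∀ x m → 0ℤ ≤ ↥ frac x m
  frac-nonNeg x ℕ.zero = 0≤+
  frac-nonNeg x (ℕ.suc m) = 0≤+

  selectedWork : Subset n → List (Fin n) → ℕ
  selectedWork I xs = sum (map (λ i → if lookupB I i then c i ℕ.* share i else 0) xs)

  selectedWork<M : ∀ I → (∀ i → i ∈ I → Lower i) → utilLower n c p Q.< 1ℚᵘ → selectedWork I (allFin n) ℕ.< M
  selectedWork<M I I-lower = ≤M·-<1 _ (sums (allFin n))
    where
    term : Fin n → ℚᵘ
    term i = if toℕ (Data.Fin.suc i) ℕ.<ᵇ n then frac (c i) (p i) else 0ℚᵘ
    term-nonNeg : ∀ i → 0ℤ ≤ ↥ term i
    term-nonNeg i with toℕ (Data.Fin.suc i) ℕ.<ᵇ n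
    ... | true = frac-nonNeg (c i) (p i)
    ... | false = 0≤+
    bound : ∀ i → (if lookupB I i then c i ℕ.* share i else 0) ≤M· term i
    bound i with lookupB I i in i∈I
    ... | false = 0≤M·nonNegative (term i) (term-nonNeg i)
    ... | true with toℕ (Data.Fin.suc i) ℕ.<ᵇ n | ℕP.<⇒<ᵇ (I-lower i (Vec.lookup⇒[]= i I i∈I))
    ...   | true | _ = ≤M·-frac (c i) (p∣M i) (p≥1 i)
    sums : ∀ xs → selectedWork I xs ≤M· Data.List.foldr Q._+_ 0ℚᵘ (map term xs)
    sums [] = 0≤M·nonNegative 0ℚᵘ 0≤+
    sums (x ∷ xs) = ≤M·-+ {if lookupB I x then c x ℕ.* share x else 0} {selectedWork I xs} (term x) _ (bound x) (sums xs)

module Admissibility {n : ℕ} (c p J : Fin n → ℕ) (p≥1 : ∀ i → 1 ℕ.≤ p i) (harmonic : Harmonic p) where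
  open import Data.Nat.Divisibility using (_∣_; divides; ∣-refl)
  open import Data.Nat.ListAction using (sum)
  open import Data.Nat.Tactic.RingSolver using () renaming (solve-∀ to ℕ-solve-∀)
  open import Data.Integer using (+_; _+_; _*_; _<_; +<+)
  open import Data.Integer.Properties
  open import Data.List using (List; []; _∷_; map)
  open import Data.List.Relation.Unary.All as All using (All; []; _∷_)
  open import Data.List.Relation.Unary.AllPairs using (AllPairs; []; _∷_)
  open import Data.Product using (_,_)
  open import Data.Unit using (tt)
  open import Relation.Binary.PropositionalEquality hiding (J)
  open IntegerFloor using (_div_; div-exact)
  open Workload c p J p≥1
  open Utilization c p p≥1

  scaledWork : List (Fin n) → ℕ
  scaledWork X = sum (map (λ b → c b ℕ.* share b) X)

  windowWork-scaled : ∀ a X → All (λ b → p b ∣ p a) X → + share a * windowWork X (p a) ≡ + scaledWork X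
  windowWork-scaled a [] [] = *-zeroʳ (+ share a)
  windowWork-scaled a (b ∷ X) (b∣a@(divides w pa≡wpb) ∷ X∣a) = begin
      + share a * (+ c b * ((+ p a) div p b) + windowWork X (p a))
    ≡⟨ *-distribˡ-+ (+ share a) _ _ ⟩
      + share a * (+ c b * ((+ p a) div p b)) + + share a * windowWork X (p a)
    ≡⟨ cong₂ _+_ first (windowWork-scaled a X X∣a) ⟩
      + (c b ℕ.* share b) + + scaledWork X
    ∎
    where
    open ≡-Reasoning
    first : + share a * (+ c b * ((+ p a) div p b)) ≡ + (c b ℕ.* share b)
    first = begin
        + share a * (+ c b * ((+ p a) div p b))
      ≡⟨ cong (λ q → + share a * (+ c b * q)) (div-exact (p≥1 b) b∣a) ⟩
        + share a * (+ c b * + w)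
      ≡⟨ cong (+ share a *_) (pos-* (c b) w) ⟨
        + share a * + (c b ℕ.* w)
      ≡⟨ pos-* (share a) (c b ℕ.* w) ⟨
        + (share a ℕ.* (c b ℕ.* w))
      ≡⟨ cong +_ (swap (share a) (c b) w) ⟩
        + (c b ℕ.* (share a ℕ.* w))
      ≡⟨ cong (λ s → + (c b ℕ.* s)) (share-ratio a b pa≡wpb) ⟩
        + (c b ℕ.* share b)
      ∎
      where
      swap : ∀ s x w → s ℕ.* (x ℕ.* w) ≡ x ℕ.* (s ℕ.* w)
      swap = ℕ-solve-∀

  sorted⇒admissible : ∀ D → AllPairs (λ x y → p y ℕ.≤ p x) D → scaledWork D ℕ.< M → Admissible D
  sorted⇒admissible [] _ _ = tt
  sorted⇒admissible (a ∷ D) (below ∷ sorted) work<M =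
    sorted⇒admissible D sorted (ℕP.≤-<-trans (ℕP.m≤n+m (scaledWork D) _) work<M) , D∣pa , <⇒≤ (*-cancelˡ-<-nonNeg (+ share a) scaled<)
    where
    D∣pa : All (λ b → p b ∣ p a) D
    D∣pa = All.map (harmonic a _) below
    scaled< : + share a * windowWork (a ∷ D) (p a) < + share a * + p a
    scaled< = begin-strict
        + share a * windowWork (a ∷ D) (p a) ≡⟨ windowWork-scaled a (a ∷ D) (∣-refl ∷ D∣pa) ⟩
        + scaledWork (a ∷ D)                 <⟨ +<+ work<M ⟩
        + M                                  ≡⟨ cong +_ (M≡share*p a) ⟩
        + (share a ℕ.* p a)                  ≡⟨ pos-* (share a) (p a) ⟩
        + share a * + p a                    ∎
      where open ≤-Reasoning

module DecisionProcedure where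
  open import Data.List using ([]; _∷_; filterᵇ; allFin)
  open import Defs using (Algorithm; lookupB)

  algorithm : Algorithm
  algorithm V n I cV dV pV JV γV kV =
    sortByPeriod (filterᵇ (lookupB I) (allFin n)) λ D → maxSlackAt (kV ∷ []) D (atLeast γV)
    where open Programs cV pV JV

module Correctness {n : ℕ} {c d p J : Fin n → ℕ} {I : Subset n} {γ k : ℕ} (H : Hyps n c d p J I γ k) where
  open import Data.Bool using (Bool; true; false; if_then_else_; T?)
  open import Function using (_∘_)
  open import Data.Bool.Properties using (T-≡)
  open import Data.Nat.ListAction using (sum)
  open import Data.Nat.ListAction.Properties using (sum-↭)
  open import Data.Nat.Tactic.RingSolver using () renaming (solve-∀ to ℕ-solve-∀)
  open import Data.Integer using (ℤ; +_; _+_; _-_; _≤_; _≤ᵇ_; +≤+)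
  open import Data.Integer.Properties
  open import Data.Integer.Tactic.RingSolver using (solve-∀)
  open import Data.List using (List; []; _∷_; map; length; filterᵇ; allFin)
  open import Data.List.Properties using (length-filter; length-tabulate)
  open import Data.List.Membership.Propositional.Properties using (∈-filter⁻)
  open import Data.List.Relation.Unary.All as All using (All)
  open import Data.List.Relation.Unary.Linked.Properties using (Linked⇒AllPairs)
  open import Data.List.Relation.Binary.Permutation.Propositional.Properties using (↭-length; ∈-resp-↭; map⁺)
  import Data.List.Sort.InsertionSort.Base as InsertionSort
  import Data.List.Sort.InsertionSort.Properties as InsertionSortProperties
  open import Data.Product using (_×_; _,_; proj₁; proj₂)
  import Data.Vec.Properties as Vec
  open import Function.Bundles using (_⇔_; mk⇔; Equivalence)
  open import Relation.Binary.PropositionalEquality hiding (J)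
  open import Defs using (lookupB; demand; Feasible; IsR; run)
  open Hyps H
  open IntegerFloor using (≤-byDifference)
  open Programs {ℤ} (λ i → + c i) (λ i → + p i) (λ i → + J i) using (sortByPeriod; maxSlackAt; atLeast)
  open Workload c p J p≥1
  open ProgramSpec c p J p≥1
  open Utilization c p p≥1 using (M; selectedWork; selectedWork<M)
  open Admissibility c p J p≥1 harmonic
  open InsertionSort byDecreasingPeriod using (sort)
  open InsertionSortProperties byDecreasingPeriod using (sort-↭; sort-↗)

  selected : List (Fin n)
  selected = filterᵇ (lookupB I) (allFin n)

  D : List (Fin n)
  D = sort selected

  sum-filter : ∀ (f : Fin n → ℕ) xs → sum (map (λ i → if lookupB I i then f i else 0) xs) ≡ sum (map f (filterᵇ (lookupB I) xs))
  sum-filter f [] = refl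
  sum-filter f (i ∷ xs) with lookupB I i
  ... | true = cong (f i ℕ.+_) (sum-filter f xs)
  ... | false = sum-filter f xs

  sum-over-I : ∀ (f : Fin n → ℕ) → sum (map f D) ≡ sum (map (λ i → if lookupB I i then f i else 0) (allFin n))
  sum-over-I f = trans (sum-↭ (map⁺ f (sort-↭ selected))) (sym (sum-filter f (allFin n)))

  D-admissible : Admissible D
  D-admissible = sorted⇒admissible D (Linked⇒AllPairs (λ q≤p r≤q → ℕP.≤-trans r≤q q≤p) (sort-↗ selected))
    (subst (ℕ._< M) (sym (sum-over-I _)) (selectedWork<M I I-lower util<1))

  D-periods≤k : All (λ a → p a ℕ.≤ k) D
  D-periods≤k = All.tabulate λ a∈D →
    k≥maxP _ (Vec.lookup⇒[]= _ I (Equivalence.to T-≡ (proj₂ (∈-filter⁻ (T? ∘ lookupB I) {xs = allFin n} (∈-resp-↭ (sort-↭ selected) a∈D)))))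

  slack-D : ∀ t → slack D (+ t) ≡ + t - + demand n I c p J t
  slack-D t = cong (λ w → + t - w) (trans (workload-ceilDiv D t) (cong +_ (sum-over-I _)))

  feasible⇔ : ∀ t → Feasible n I c p J γ t ⇔ (+ γ ≤ slack D (+ t))
  feasible⇔ t = mk⇔
    (λ feasible → ≤-byDifference _ (trans (cong (λ s → s - + γ) (slack-D t)) (regroup (+ t) (+ dem) (+ γ)))
                    (i≤j⇒0≤j-i (+≤+ feasible)))
    (λ γ≤slack → drop‿+≤+ (≤-byDifference _ (sym (regroup (+ t) (+ dem) (+ γ)))
                    (i≤j⇒0≤j-i (subst (+ γ ≤_) (slack-D t) γ≤slack))))
    where
    dem = demand n I c p J t
    regroup : ∀ t d g → t - d - g ≡ t - (g + d)
    regroup = solve-∀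

  answer : Bool
  answer = + γ ≤ᵇ maxSlack D (+ k)

  answer-correct : ∀ r → IsR n I c p J γ r → (answer ≡ true) ⇔ (r ℕ.≤ k)
  answer-correct r (r-feasible , r-least) = mk⇔ sound complete
    where
    sound : answer ≡ true → r ℕ.≤ k
    sound accepted =
      let (t , t≤k , max≤slack-t) = maxSlack-attained D (+ k)
          (t′ , t′≤k , slack-t≤slack-t′) = slack-from-nonNegative D D-admissible D-periods≤k t t≤k
          γ≤slack-t′ = ≤-trans (≤ᵇ⇒≤ (Equivalence.from T-≡ accepted)) (≤-trans max≤slack-t slack-t≤slack-t′)
      in ℕP.≤-trans (r-least t′ (Equivalence.from (feasible⇔ t′) γ≤slack-t′)) t′≤k
    complete : r ℕ.≤ k → answer ≡ true
    complete r≤k = Equivalence.to T-≡ (≤⇒≤ᵇ (≤-trans (Equivalence.to (feasible⇔ r) r-feasible)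
                                                  (slack≤maxSlack D D-admissible (+≤+ r≤k))))

  run-algorithm : Bool × ℕ
  run-algorithm = run (DecisionProcedure.algorithm _ n I (λ i → + c i) (λ i → + d i) (λ i → + p i) (λ i → + J i) (+ γ) (+ k))

  algorithm-yields : Yielding.Yields (λ κ → sortByPeriod selected (λ E → maxSlackAt (+ k ∷ []) E κ))
                                     (maxSlack D (+ k) ∷ []) (length selected ℕ.* length selected ℕ.+ maxSlackCost 1 (length D))
  algorithm-yields = Yielding.yields-bind {m = sortByPeriod selected} {f = λ E κ → maxSlackAt (+ k ∷ []) E κ}
    (sortByPeriod-yields selected) (maxSlackAt-yields D D-admissible (+ k ∷ []))

  run-answer : proj₁ run-algorithm ≡ answer
  run-answer = proj₁ (algorithm-yields (atLeast (+ γ)))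

  quadratic : ∀ {L m} → 1 ℕ.≤ m → L ℕ.≤ m → L ℕ.* L ℕ.+ 11 ℕ.* (L ℕ.* (L ℕ.+ 1)) ℕ.+ 1 ℕ.≤ 24 ℕ.* (m ℕ.* m)
  quadratic {L} {ℕ.suc m} _ L≤m = begin
      L ℕ.* L ℕ.+ 11 ℕ.* (L ℕ.* (L ℕ.+ 1)) ℕ.+ 1
    ≤⟨ ℕP.+-monoˡ-≤ 1 (ℕP.+-mono-≤ (ℕP.*-mono-≤ L≤m L≤m) (ℕP.*-monoʳ-≤ 11 (ℕP.*-mono-≤ L≤m (ℕP.+-monoˡ-≤ 1 L≤m)))) ⟩
      m′ ℕ.* m′ ℕ.+ 11 ℕ.* (m′ ℕ.* (m′ ℕ.+ 1)) ℕ.+ 1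
    ≤⟨ ℕP.m≤m+n _ (12 ℕ.* (m ℕ.* m) ℕ.+ 13 ℕ.* m) ⟩
      m′ ℕ.* m′ ℕ.+ 11 ℕ.* (m′ ℕ.* (m′ ℕ.+ 1)) ℕ.+ 1 ℕ.+ (12 ℕ.* (m ℕ.* m) ℕ.+ 13 ℕ.* m)
    ≡⟨ expand m ⟩
      24 ℕ.* (m′ ℕ.* m′)
    ∎
    where
    open ℕP.≤-Reasoning
    m′ = ℕ.suc m
    expand : ∀ m → ℕ.suc m ℕ.* ℕ.suc m ℕ.+ 11 ℕ.* (ℕ.suc m ℕ.* (ℕ.suc m ℕ.+ 1)) ℕ.+ 1 ℕ.+ (12 ℕ.* (m ℕ.* m) ℕ.+ 13 ℕ.* m)
                 ≡ 24 ℕ.* (ℕ.suc m ℕ.* ℕ.suc m)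
    expand = ℕ-solve-∀

  run-cost : proj₂ run-algorithm ℕ.≤ 24 ℕ.* (n ℕ.* n)
  run-cost = begin
      proj₂ run-algorithm                            ≤⟨ proj₂ (algorithm-yields (atLeast (+ γ))) ⟩
      L ℕ.* L ℕ.+ maxSlackCost 1 (length D) ℕ.+ 1    ≡⟨ cong (λ m → L ℕ.* L ℕ.+ maxSlackCost 1 m ℕ.+ 1) (↭-length (sort-↭ selected)) ⟩
      L ℕ.* L ℕ.+ maxSlackCost 1 L ℕ.+ 1             ≤⟨ ℕP.+-monoˡ-≤ 1 (ℕP.+-monoʳ-≤ (L ℕ.* L) (maxSlackCost-bound 1 L)) ⟩
      L ℕ.* L ℕ.+ 11 ℕ.* (L ℕ.* (L ℕ.+ 1)) ℕ.+ 1     ≤⟨ quadratic (ℕP.≤-trans (ℕ.s≤s ℕ.z≤n) n≥2) L≤n ⟩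
      24 ℕ.* (n ℕ.* n)                               ∎
    where
    open ℕP.≤-Reasoning
    L = length selected
    L≤n : L ℕ.≤ n
    L≤n = ℕP.≤-trans (length-filter (T? ∘ lookupB I) (allFin n)) (ℕP.≤-reflexive (length-tabulate (λ i → i)))

  run-decides : ∀ r → IsR n I c p J γ r → (proj₁ run-algorithm ≡ true) ⇔ (r ℕ.≤ k)
  run-decides r isR = subst (λ b → (b ≡ true) ⇔ (r ℕ.≤ k)) (sym run-answer) (answer-correct r isR)

open import Defs
open import Data.Nat using (ℕ; _≤_; _*_)
open import Data.Integer using (+_)
open import Data.Fin using (Fin)
open import Data.Fin.Subset using (Subset)
open import Data.Bool using (true)
open import Data.Product using (Σ; _×_; _,_; proj₁; proj₂; ∃-syntax)
open import Function.Bundles using (_⇔_)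
open import Relation.Binary.PropositionalEquality using (_≡_)

theorem11 : ∃[ C ] Σ Algorithm λ A →
    ∀ (n : ℕ) (c d p J : Fin n → ℕ) (I : Subset n) (γ k : ℕ) →
    Hyps n c d p J I γ k →
    proj₂ (run (A _ n I (λ i → + c i) (λ i → + d i) (λ i → + p i) (λ i → + J i) (+ γ) (+ k))) ≤ C * (n * n)
    × (∀ r → IsR n I c p J γ r →
    (proj₁ (run (A _ n I (λ i → + c i) (λ i → + d i) (λ i → + p i) (λ i → + J i) (+ γ) (+ k))) ≡ true) ⇔ (r ≤ k))
theorem11 = 24 , DecisionProcedure.algorithm , λ n c d p J I γ k H →
  Correctness.run-cost H , Correctness.run-decides H
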